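{- Let $G$ be a finite weighted directed acyclic graph (each vertex $v$ carries a real weight $w(v)$). If $G$ has a non-negative mark-unmark sequence, then $G$ also has a non-negative mark sequence.
   Context: A set $M$ of vertices of a DAG $G$ is inward closed if for every edge $uv\in E(G)$, $v\in M$ implies $u\in M$. For a set $X$ of vertices, $w(X)=\sum_{x\in X}w(x)$. A mark sequence of $G$ (with $n$ vertices) is a sequence $M_1,\dots,M_n$ of subsets of $V(G)$ where $M_1=\{v\}$ for some source $v$, and for $i=2,\dots,n$, $M_i=M_{i-1}\cup\{u\}$ for some $u\notin M_{i-1}$ such that $M_{i-1}\cup\{u\}$ is inward closed ("marking" $u$). A mark-unmark sequence of $G$ is a sequence $M_1,M_2,\dots,M_t$ of subsets of $V(G)$ where $M_1=\{v\}$ for some source $v$, and for each $i\ge 2$ either $M_i=M_{i-1}\cup\{u\}$ for some $u\notin M_{i-1}$ with $M_{i-1}\cup\{u\}$ inward closed (marking $u$), or $M_i=M_{i-1}\setminus\{u\}$ for some $u\in M_{i-1}$ with $M_{i-1}\setminus\{u\}$ inward closed (unmarking $u$); the sequence stops at the first $t$ with $M_t=V(G)$. A mark or mark-unmark sequence is non-negative if $w(M_i)\ge 0$ for every $i$. -}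

module Defs where

open import Level using (Level; _⊔_)
open import Data.Nat using (ℕ; zero; suc)
open import Data.Fin using (Fin) renaming (zero to fzero; suc to fsuc)
open import Data.Fin.Subset using (Subset; ⊤; ⁅_⁆; _∈_; _∉_; _∪_; _-_; inside; outside)
open import Data.Vec using ([]; _∷_)
open import Data.List using (List; []; _∷_; _∷ʳ_; length)
open import Data.List.Relation.Unary.All using (All)
open import Data.List.Relation.Unary.Linked using (Linked)
open import Data.Product using (Σ; ∃; _×_)
open import Data.Sum using (_⊎_)
open import Relation.Nullary using (¬_)
open import Relation.Binary.PropositionalEquality using (_≡_; _≢_)
open import Relation.Binary.Core using (Rel)
open import Relation.Binary.Structures using (IsTotalOrder)
open import Relation.Binary.Construct.Closure.Transitive using (TransClosure)
open import Algebra.Core using (Op₁; Op₂)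
open import Algebra.Structures using (IsAbelianGroup)

-- Weights: a totally ordered abelian group (the real numbers (ℝ,+,≤)
-- being the intended instance; Agda's stdlib has no reals).

record OrderedAbelianGroup (c ℓ₁ ℓ₂ : Level) : Set (Level.suc (c ⊔ ℓ₁ ⊔ ℓ₂)) where
  infixl 6 _+_
  infix  4 _≈_ _≤_
  field
    Carrier        : Set c
    _≈_            : Rel Carrier ℓ₁
    _≤_            : Rel Carrier ℓ₂
    _+_            : Op₂ Carrier
    0#             : Carrier
    neg            : Op₁ Carrier
    isAbelianGroup : IsAbelianGroup _≈_ _+_ 0# neg
    isTotalOrder   : IsTotalOrder _≈_ _≤_
    +-monoˡ-≤      : ∀ {x y} z → x ≤ y → x + z ≤ y + z

-- Finite directed acyclic graphs on vertex set Fin n.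
-- E u v means there is an edge u → v.

Acyclic : ∀ {n} → (Fin n → Fin n → Set) → Set
Acyclic E = ∀ v → ¬ TransClosure E v v

IsSource : ∀ {n} → (Fin n → Fin n → Set) → Fin n → Set
IsSource E v = ∀ u → ¬ E u v

InwardClosed : ∀ {n} → (Fin n → Fin n → Set) → Subset n → Set
InwardClosed E M = ∀ u v → E u v → v ∈ M → u ∈ M

module _ {c ℓ₁ ℓ₂} (A : OrderedAbelianGroup c ℓ₁ ℓ₂) where
  open OrderedAbelianGroup A

  weightOf : ∀ {n} → (Fin n → Carrier) → Subset n → Carrier
  weightOf {zero}  w []            = 0#
  weightOf {suc n} w (inside  ∷ p) = w fzero + weightOf (λ i → w (fsuc i)) p
  weightOf {suc n} w (outside ∷ p) = weightOf (λ i → w (fsuc i)) p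

  NonNegative : ∀ {n} → (Fin n → Carrier) → List (Subset n) → Set ℓ₂
  NonNegative w Ms = All (λ M → 0# ≤ weightOf w M) Ms

MarkStep : ∀ {n} → (Fin n → Fin n → Set) → Subset n → Subset n → Set
MarkStep E M M' = ∃ λ u → u ∉ M × M' ≡ M ∪ ⁅ u ⁆ × InwardClosed E M'

UnmarkStep : ∀ {n} → (Fin n → Fin n → Set) → Subset n → Subset n → Set
UnmarkStep E M M' = ∃ λ u → u ∈ M × M' ≡ M - u × InwardClosed E M'

MarkUnmarkStep : ∀ {n} → (Fin n → Fin n → Set) → Subset n → Subset n → Set
MarkUnmarkStep E M M' = MarkStep E M M' ⊎ UnmarkStep E M M'

StartsAtSource : ∀ {n} → (Fin n → Fin n → Set) → List (Subset n) → Set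
StartsAtSource E Ms = ∃ λ v → IsSource E v × ∃ λ rest → Ms ≡ ⁅ v ⁆ ∷ rest

-- A mark sequence: M₁ = {v} for a source v, then n − 1 marking steps
-- (so the list has exactly n entries).
IsMarkSequence : ∀ {n} → (Fin n → Fin n → Set) → List (Subset n) → Set
IsMarkSequence {n} E Ms =
  StartsAtSource E Ms × Linked (MarkStep E) Ms × length Ms ≡ n

-- A mark-unmark sequence: M₁ = {v} for a source v, each subsequent set
-- obtained by marking or unmarking, and stopping at the first t with
-- M_t = V(G) (the last entry is V(G), no earlier entry is).
IsMarkUnmarkSequence : ∀ {n} → (Fin n → Fin n → Set) → List (Subset n) → Set
IsMarkUnmarkSequence E Ms =
  StartsAtSource E Ms × Linked (MarkUnmarkStep E) Ms ×
  (∃ λ init → Ms ≡ init ∷ʳ ⊤ × All (λ M → M ≢ ⊤) init)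

module Submission where

-- Let L = M₁, …, M_t be the given mark-unmark sequence and call a set
-- closed if it is downward closed for the preorder "every Mᵢ containing v
-- contains u".  Closed sets contain every Mᵢ, are inward closed, form a
-- decidable family, and are stable under ∪ and ∩; the weight w is modular
-- on them: w(P ∪ Q) + w(P ∩ Q) = w(P) + w(Q).  Call D reachable if it is
-- obtained from ∅ by adding one vertex at a time through non-negative
-- closed sets.  Along the sequence we maintain a reachable closed Dᵢ ⊇ Mᵢ
-- which is heaviest among the closed sets between Mᵢ and Dᵢ.  If M_{i+1}
-- marks u, then Dᵢ ∪ {u} is reachable by modularity; in both cases the
-- heaviest closed set Y between M_{i+1} and the current bound is again
-- reachable, because intersecting every set of a reaching path with Y
-- keeps it non-negative (modularity once more).  At the end M_t = V(G),
-- so V(G) is reachable, and deleting the idle steps of the path yields a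
-- non-negative mark sequence; its first set is a source since E has no
-- self-loops.

open import Defs
open import Data.Nat using (ℕ; zero; suc) renaming (_+_ to _+ℕ_)
open import Data.Nat.Properties using (+-suc; +-identityʳ)
open import Data.Fin using (Fin) renaming (zero to fzero; suc to fsuc)
import Data.Fin.Properties as Fin
open import Data.Fin.Subset
  using (Subset; ⊤; ⊥; ⁅_⁆; _∈_; _∉_; _∪_; _∩_; _⊆_; ∣_∣; inside; outside)
open import Data.Fin.Subset.Properties
  using ( _∈?_; _⊆?_; ⊆-refl; ⊆-antisym; ⊆-trans; ⊆⊤; ⊥⊆; ∉⊥; x∈⁅x⁆; x∈⁅y⁆⇒x≡y
        ; x∈p∪q⁺; x∈p∪q⁻; x∈p∩q⁺; x∈p∩q⁻; p⊆p∪q; q⊆p∪q; p∩q⊆p; p∩q⊆q; p─q⊆p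
        ; ∪-assoc; ∪-identityˡ; ∪-identityʳ; ∩-comm; ∩-zeroˡ
        ; ∩-distribʳ-∪; ∣⊥∣≡0; ∣⊤∣≡n )
open import Data.Vec using ([]; _∷_; here; there)
open import Data.List using (List; []; _∷_; length; map; filter; _++_)
open import Data.List.Relation.Unary.All using (All; []; _∷_)
import Data.List.Relation.Unary.All as All
open import Data.List.Relation.Unary.Any using (here)
open import Data.List.Relation.Unary.Linked using (Linked; [-]; _∷_)
import Data.List.Relation.Unary.Linked as Linked
open import Data.List.Membership.Propositional using () renaming (_∈_ to _∈ₗ_)
open import Data.List.Membership.Propositional.Properties
  using (∈-map⁺; ∈-++⁺ˡ; ∈-++⁺ʳ; ∈-filter⁺; ∈-filter⁻)
import Data.List.Extrema
open import Data.Product using (∃; _×_; _,_; proj₂)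
import Data.Product
open import Data.Sum using (inj₁; inj₂; [_,_]′)
import Data.Sum
open import Function using (_∘_)
open import Relation.Nullary using (yes; no; contradiction)
open import Relation.Nullary.Decidable using (_×-dec_; _→-dec_)
open import Relation.Unary using (Decidable)
open import Relation.Binary.Bundles using (TotalOrder)
open import Relation.Binary.PropositionalEquality
  using (_≡_; refl; sym; trans; cong; subst; subst₂; module ≡-Reasoning)
open import Relation.Binary.Construct.Closure.Transitive using ([_])
open import Relation.Binary.Construct.Closure.ReflexiveTransitive
  using (Star; ε; _◅_; _◅◅_)
open import Algebra.Structures using (IsAbelianGroup)
open import Relation.Binary.Structures using (IsTotalOrder)

module OrderedGroupProperties {c ℓ₁ ℓ₂} (A : OrderedAbelianGroup c ℓ₁ ℓ₂) where
  open OrderedAbelianGroup A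
  private
    module G = IsAbelianGroup isAbelianGroup
    module O = IsTotalOrder isTotalOrder
  open import Relation.Binary.Reasoning.Setoid G.setoid

  -- The order as a stdlib total order, to use the list extrema library.
  totalOrder : TotalOrder c ℓ₁ ℓ₂
  totalOrder = record { Carrier = Carrier ; _≈_ = _≈_ ; _≤_ = _≤_
                      ; isTotalOrder = isTotalOrder }

  ≤-respʳ-≈ : ∀ {x y z} → x ≤ y → y ≈ z → x ≤ z
  ≤-respʳ-≈ x≤y y≈z = O.≲-respʳ-≈ y≈z x≤y

  ≤-respˡ-≈ : ∀ {x y z} → x ≈ y → y ≤ z → x ≤ z
  ≤-respˡ-≈ x≈y y≤z = O.≲-respˡ-≈ (G.sym x≈y) y≤z

  +-cancelʳ-≤ : ∀ {x y} z → x + z ≤ y + z → x ≤ y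
  +-cancelʳ-≤ {x} {y} z x+z≤y+z =
    ≤-respˡ-≈ (G.sym (undo x)) (≤-respʳ-≈ (+-monoˡ-≤ (neg z) x+z≤y+z) (undo y))
    where
    undo : ∀ t → (t + z) + neg z ≈ t
    undo t = begin
      (t + z) + neg z ≈⟨ G.assoc t z (neg z) ⟩
      t + (z + neg z) ≈⟨ G.∙-congˡ (G.inverseʳ z) ⟩
      t + 0#          ≈⟨ G.identityʳ t ⟩
      t               ∎

  +-monoʳ-≤ : ∀ {y z} x → y ≤ z → x + y ≤ x + z
  +-monoʳ-≤ {y} {z} x y≤z =
    ≤-respˡ-≈ (G.comm x y) (≤-respʳ-≈ (+-monoˡ-≤ x y≤z) (G.comm z x))

  balance : ∀ {a b c d} → a + b ≈ c + d → b ≤ c → d ≤ a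
  balance {a} {b} {c} {d} sum b≤c =
    +-cancelʳ-≤ b (≤-respʳ-≈ (+-monoʳ-≤ d b≤c) (G.trans (G.comm d c) (G.sym sum)))

  middle-swap : ∀ a b x y → (a + x) + (b + y) ≈ (a + b) + (x + y)
  middle-swap a b x y = begin
    (a + x) + (b + y) ≈⟨ G.assoc a x (b + y) ⟩
    a + (x + (b + y)) ≈⟨ G.∙-congˡ (G.sym (G.assoc x b y)) ⟩
    a + ((x + b) + y) ≈⟨ G.∙-congˡ (G.∙-congʳ (G.comm x b)) ⟩
    a + ((b + x) + y) ≈⟨ G.∙-congˡ (G.assoc b x y) ⟩
    a + (b + (x + y)) ≈⟨ G.sym (G.assoc a b (x + y)) ⟩
    (a + b) + (x + y) ∎

  left-comm : ∀ a x y → a + (x + y) ≈ x + (a + y)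
  left-comm a x y = begin
    a + (x + y) ≈⟨ G.sym (G.assoc a x y) ⟩
    (a + x) + y ≈⟨ G.∙-congʳ (G.comm a x) ⟩
    (x + a) + y ≈⟨ G.assoc x a y ⟩
    x + (a + y) ∎

module WeightProperties {c ℓ₁ ℓ₂} (A : OrderedAbelianGroup c ℓ₁ ℓ₂) where
  open OrderedAbelianGroup A
  open OrderedGroupProperties A
  private
    module G = IsAbelianGroup isAbelianGroup
  open import Relation.Binary.Reasoning.Setoid G.setoid

  -- w(P ∪ Q) + w(P ∩ Q) = w(P) + w(Q): each vertex is counted equally
  -- often on both sides.
  weight-modular : ∀ {m} (w : Fin m → Carrier) (p q : Subset m) →
    weightOf A w (p ∪ q) + weightOf A w (p ∩ q) ≈ weightOf A w p + weightOf A w q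
  weight-modular w [] [] = G.refl
  weight-modular w (s ∷ p) (t ∷ q) = step s t
    where
    w′ = λ i → w (fsuc i)
    a = w fzero
    X = weightOf A w′ (p ∪ q)
    Y = weightOf A w′ (p ∩ q)
    P = weightOf A w′ p
    Q = weightOf A w′ q
    ih : X + Y ≈ P + Q
    ih = weight-modular w′ p q
    step : ∀ s t → weightOf A w ((s ∷ p) ∪ (t ∷ q)) + weightOf A w ((s ∷ p) ∩ (t ∷ q))
                   ≈ weightOf A w (s ∷ p) + weightOf A w (t ∷ q)
    step inside inside = begin
      (a + X) + (a + Y) ≈⟨ middle-swap a a X Y ⟩
      (a + a) + (X + Y) ≈⟨ G.∙-congˡ ih ⟩
      (a + a) + (P + Q) ≈⟨ middle-swap a a P Q ⟨
      (a + P) + (a + Q) ∎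
    step inside outside = begin
      (a + X) + Y ≈⟨ G.assoc a X Y ⟩
      a + (X + Y) ≈⟨ G.∙-congˡ ih ⟩
      a + (P + Q) ≈⟨ G.assoc a P Q ⟨
      (a + P) + Q ∎
    step outside inside = begin
      (a + X) + Y ≈⟨ G.assoc a X Y ⟩
      a + (X + Y) ≈⟨ G.∙-congˡ ih ⟩
      a + (P + Q) ≈⟨ left-comm a P Q ⟩
      P + (a + Q) ∎
    step outside outside = ih

  module _ {m} (w : Fin m → Carrier) (p q : Subset m) where
    private
      W = weightOf A w

    ∪-heavier : W (p ∩ q) ≤ W p → W q ≤ W (p ∪ q)
    ∪-heavier = balance (weight-modular w p q)

    ∩-heavier : W (p ∪ q) ≤ W q → W p ≤ W (p ∩ q)
    ∩-heavier = balance (G.trans (G.comm _ _) (G.trans (weight-modular w p q) (G.comm _ _)))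

module _ {m : ℕ} where

  ⁅⁆⊆ : ∀ {u : Fin m} {p} → u ∈ p → ⁅ u ⁆ ⊆ p
  ⁅⁆⊆ {u} u∈p x∈⁅u⁆ = subst (_∈ _) (sym (x∈⁅y⁆⇒x≡y u x∈⁅u⁆)) u∈p

  ∪-least : ∀ {p q r : Subset m} → p ⊆ r → q ⊆ r → p ∪ q ⊆ r
  ∪-least {p} {q} p⊆r q⊆r x∈ = [ p⊆r , q⊆r ]′ (x∈p∪q⁻ p q x∈)

  ⊆⇒∪≡ : ∀ {p q : Subset m} → q ⊆ p → p ∪ q ≡ p
  ⊆⇒∪≡ {p} {q} q⊆p = ⊆-antisym (∪-least ⊆-refl q⊆p) (p⊆p∪q q)

  ⊆⇒∩≡ : ∀ {p q : Subset m} → q ⊆ p → p ∩ q ≡ q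
  ⊆⇒∩≡ {p} {q} q⊆p = ⊆-antisym (p∩q⊆q p q) (λ x∈q → x∈p∩q⁺ (q⊆p x∈q , x∈q))

  ⁅⁆∩-∉ : ∀ {u : Fin m} {p} → u ∉ p → ⁅ u ⁆ ∩ p ≡ ⊥
  ⁅⁆∩-∉ {u} {p} u∉p = ⊆-antisym (λ x∈ → contradiction (u∈p x∈) u∉p) ⊥⊆
    where
    u∈p : ∀ {x} → x ∈ ⁅ u ⁆ ∩ p → u ∈ p
    u∈p x∈ with x∈p∩q⁻ ⁅ u ⁆ p x∈
    ... | x∈⁅u⁆ , x∈p = subst (_∈ p) (x∈⁅y⁆⇒x≡y u x∈⁅u⁆) x∈p

  ∪⁅⁆-∩-∈ : ∀ {u : Fin m} r {y} → u ∈ y → (r ∪ ⁅ u ⁆) ∩ y ≡ (r ∩ y) ∪ ⁅ u ⁆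
  ∪⁅⁆-∩-∈ {u} r {y} u∈y = begin
    (r ∪ ⁅ u ⁆) ∩ y         ≡⟨ ∩-distribʳ-∪ y r ⁅ u ⁆ ⟩
    (r ∩ y) ∪ (⁅ u ⁆ ∩ y)   ≡⟨ cong ((r ∩ y) ∪_) (trans (∩-comm ⁅ u ⁆ y) (⊆⇒∩≡ (⁅⁆⊆ u∈y))) ⟩
    (r ∩ y) ∪ ⁅ u ⁆         ∎
    where open ≡-Reasoning

  ∪⁅⁆-∩-∉ : ∀ {u : Fin m} r {y} → u ∉ y → (r ∪ ⁅ u ⁆) ∩ y ≡ r ∩ y
  ∪⁅⁆-∩-∉ {u} r {y} u∉y = begin
    (r ∪ ⁅ u ⁆) ∩ y         ≡⟨ ∩-distribʳ-∪ y r ⁅ u ⁆ ⟩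
    (r ∩ y) ∪ (⁅ u ⁆ ∩ y)   ≡⟨ cong ((r ∩ y) ∪_) (⁅⁆∩-∉ u∉y) ⟩
    (r ∩ y) ∪ ⊥             ≡⟨ ∪-identityʳ (r ∩ y) ⟩
    r ∩ y                   ∎
    where open ≡-Reasoning

  ∪-∪⁅⁆ : ∀ {d p : Subset m} u → p ⊆ d → d ∪ (p ∪ ⁅ u ⁆) ≡ d ∪ ⁅ u ⁆
  ∪-∪⁅⁆ {d} {p} u p⊆d = trans (sym (∪-assoc d p ⁅ u ⁆)) (cong (_∪ ⁅ u ⁆) (⊆⇒∪≡ p⊆d))

∣∪⁅⁆∣ : ∀ {m} (p : Subset m) x → x ∉ p → ∣ p ∪ ⁅ x ⁆ ∣ ≡ suc ∣ p ∣
∣∪⁅⁆∣ (inside  ∷ p) fzero    x∉p = contradiction here x∉p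
∣∪⁅⁆∣ (outside ∷ p) fzero    x∉p = cong (suc ∘ ∣_∣) (∪-identityʳ p)
∣∪⁅⁆∣ (inside  ∷ p) (fsuc x) x∉p = cong suc (∣∪⁅⁆∣ p x (x∉p ∘ there))
∣∪⁅⁆∣ (outside ∷ p) (fsuc x) x∉p = ∣∪⁅⁆∣ p x (x∉p ∘ there)

allSubsets : ∀ m → List (Subset m)
allSubsets zero    = [] ∷ []
allSubsets (suc m) = map (inside ∷_) (allSubsets m) ++ map (outside ∷_) (allSubsets m)

∈-allSubsets : ∀ {m} (p : Subset m) → p ∈ₗ allSubsets m
∈-allSubsets []            = here refl
∈-allSubsets (inside  ∷ p) = ∈-++⁺ˡ (∈-map⁺ (inside ∷_) (∈-allSubsets p))
∈-allSubsets {suc m} (outside ∷ p) =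
  ∈-++⁺ʳ (map (inside ∷_) (allSubsets m)) (∈-map⁺ (outside ∷_) (∈-allSubsets p))

-- A move of a mark-unmark sequence, forgetting inward closure: add a
-- vertex, or pass to a subset.
data Move {m} (p : Subset m) : Subset m → Set where
  grow   : ∀ u → Move p (p ∪ ⁅ u ⁆)
  shrink : ∀ {q} → q ⊆ p → Move p q

-- Reaching paths through a family of sets

module Paths {c ℓ₁ ℓ₂} (A : OrderedAbelianGroup c ℓ₁ ℓ₂) {n : ℕ}
             (w : Fin n → OrderedAbelianGroup.Carrier A)
             (Closed : Subset n → Set) where
  open OrderedAbelianGroup A

  W : Subset n → Carrier
  W = weightOf A w

  NonNeg : Subset n → Set ℓ₂
  NonNeg s = 0# ≤ W s

  -- One step of a reaching path adds a vertex (possibly one already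
  -- present) and lands on a closed set of non-negative weight.
  data Step (d : Subset n) : Subset n → Set ℓ₂ where
    add : ∀ u → Closed (d ∪ ⁅ u ⁆) → NonNeg (d ∪ ⁅ u ⁆) → Step d (d ∪ ⁅ u ⁆)

  Reachable : Subset n → Set ℓ₂
  Reachable = Star Step ⊥

  idle : ∀ {r s} → r ≡ s → Star Step r s
  idle refl = ε

  path-⊆ : ∀ {r t} → Star Step r t → r ⊆ t
  path-⊆ ε                    = ⊆-refl
  path-⊆ (add u _ _ ◅ steps) = path-⊆ steps ∘ p⊆p∪q ⁅ u ⁆

module HeaviestReachable
    {c ℓ₁ ℓ₂} (A : OrderedAbelianGroup c ℓ₁ ℓ₂) {n : ℕ}
    (w : Fin n → OrderedAbelianGroup.Carrier A)
    (Closed : Subset n → Set) (closed? : Decidable Closed)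
    (closed-⊥ : Closed ⊥)
    (closed-∪ : ∀ {p q} → Closed p → Closed q → Closed (p ∪ q))
    (closed-∩ : ∀ {p q} → Closed p → Closed q → Closed (p ∩ q)) where
  open OrderedAbelianGroup A
  open OrderedGroupProperties A using (totalOrder)
  open WeightProperties A using (∪-heavier; ∩-heavier)
  open Paths A w Closed public
  private
    module O = IsTotalOrder isTotalOrder

  Between : Subset n → Subset n → Subset n → Set
  Between m d z = Closed z × m ⊆ z × z ⊆ d

  between? : ∀ m d → Decidable (Between m d)
  between? m d z = closed? z ×-dec (m ⊆? z) ×-dec (z ⊆? d)

  Heaviest : Subset n → Subset n → Subset n → Set ℓ₂
  Heaviest m d y = ∀ z → Between m d z → W z ≤ W y

  heaviest : ∀ m d → Between m d d → ∃ λ y → Between m d y × Heaviest m d y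
  heaviest m d d-between = y , y-between , y-heaviest
    where
    open Data.List.Extrema totalOrder using (argmax; argmax-all; f[xs]≤f[argmax])
    candidates : List (Subset n)
    candidates = filter (between? m d) (allSubsets n)
    y : Subset n
    y = argmax W d candidates
    y-between : Between m d y
    y-between = argmax-all W {xs = candidates} d-between
                  (All.tabulate (proj₂ ∘ ∈-filter⁻ (between? m d) {xs = allSubsets n}))
    y-heaviest : Heaviest m d y
    y-heaviest z z-between = All.lookup (f[xs]≤f[argmax] {f = W} d candidates)
                               (∈-filter⁺ (between? m d) (∈-allSubsets z) z-between)

  -- Cutting a path down to a set Y that is heaviest between Y and D:
  -- every set R ⊆ D of the path has w(R ∪ Y) ≤ w(Y), so by modularity
  -- w(R ∩ Y) ≥ w(R) ≥ 0, and R ∩ Y is again closed.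
  module Cut {y d} (y-closed : Closed y) (y⊆d : y ⊆ d) (y-heaviest : Heaviest y d y) where

    cut-step : ∀ {r r′} → Step r r′ → r′ ⊆ d → Star Step (r ∩ y) (r′ ∩ y)
    cut-step {r} (add u r′-closed r′-nonneg) r′⊆d with u ∈? y
    ... | no  u∉y = idle (sym (∪⁅⁆-∩-∉ r u∉y))
    ... | yes u∈y = subst (Star Step (r ∩ y)) (sym r′∩y)
                      (add u (subst Closed r′∩y cut-closed) (subst NonNeg r′∩y cut-nonneg) ◅ ε)
      where
      r′ = r ∪ ⁅ u ⁆
      r′∩y : r′ ∩ y ≡ (r ∩ y) ∪ ⁅ u ⁆
      r′∩y = ∪⁅⁆-∩-∈ r u∈y
      cut-closed : Closed (r′ ∩ y)
      cut-closed = closed-∩ r′-closed y-closed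
      union-light : W (r′ ∪ y) ≤ W y
      union-light = y-heaviest (r′ ∪ y) (closed-∪ r′-closed y-closed , q⊆p∪q r′ y , ∪-least r′⊆d y⊆d)
      cut-nonneg : NonNeg (r′ ∩ y)
      cut-nonneg = O.trans r′-nonneg (∩-heavier w r′ y union-light)

    cut : ∀ {r t} → Star Step r t → t ⊆ d → Star Step (r ∩ y) (t ∩ y)
    cut ε                t⊆d = ε
    cut (step ◅ steps) t⊆d = cut-step step (⊆-trans (path-⊆ steps) t⊆d) ◅◅ cut steps t⊆d

  Feasible : Subset n → Subset n → Set ℓ₂
  Feasible m d = Reachable d × Between m d d

  Optimal : Subset n → Subset n → Set ℓ₂
  Optimal m d = Feasible m d × Heaviest m d d

  -- A feasible bound can be replaced by an optimal one: the heaviest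
  -- closed set between M and D, reached by cutting the path to D.
  optimise : ∀ {m d} → Feasible m d → ∃ (Optimal m)
  optimise {m} {d} (reach , d-between) with heaviest m d d-between
  ... | y , (y-closed , m⊆y , y⊆d) , y-heaviest =
    y , (y-reachable , y-closed , m⊆y , ⊆-refl) , y-optimal
    where
    open Cut y-closed y⊆d (λ z (z-closed , y⊆z , z⊆d) →
                             y-heaviest z (z-closed , ⊆-trans m⊆y y⊆z , z⊆d))
    y-reachable : Reachable y
    y-reachable = subst₂ (Star Step) (∩-zeroˡ y) (⊆⇒∩≡ y⊆d) (cut reach ⊆-refl)
    y-optimal : Heaviest m y y
    y-optimal z (z-closed , m⊆z , z⊆y) = y-heaviest z (z-closed , m⊆z , ⊆-trans z⊆y y⊆d)

  -- Marking u in M: D ∪ {u} = D ∪ M′ for M′ = M ∪ {u} is a feasible bound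
  -- for M′, since D ∩ M′ lies between M and D, so w(D ∩ M′) ≤ w(D) and by
  -- modularity w(D ∪ M′) ≥ w(M′) ≥ 0.
  extend : ∀ {m d} u → Optimal m d → Closed (m ∪ ⁅ u ⁆) → NonNeg (m ∪ ⁅ u ⁆) →
           Feasible (m ∪ ⁅ u ⁆) (d ∪ ⁅ u ⁆)
  extend {m} {d} u ((reach , d-closed , m⊆d , _) , d-optimal) m′-closed m′-nonneg =
    reach ◅◅ add u d′-closed d′-nonneg ◅ ε , d′-closed , m′⊆d′ , ⊆-refl
    where
    m′ = m ∪ ⁅ u ⁆
    d∪m′ : d ∪ m′ ≡ d ∪ ⁅ u ⁆
    d∪m′ = ∪-∪⁅⁆ u m⊆d
    meet-light : W (d ∩ m′) ≤ W d
    meet-light = d-optimal (d ∩ m′) ( closed-∩ d-closed m′-closed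
                                    , (λ x∈m → x∈p∩q⁺ (m⊆d x∈m , p⊆p∪q ⁅ u ⁆ x∈m))
                                    , p∩q⊆p d m′ )
    d′-closed : Closed (d ∪ ⁅ u ⁆)
    d′-closed = subst Closed d∪m′ (closed-∪ d-closed m′-closed)
    d′-nonneg : NonNeg (d ∪ ⁅ u ⁆)
    d′-nonneg = subst NonNeg d∪m′ (O.trans m′-nonneg (∪-heavier w d m′ meet-light))
    m′⊆d′ : m′ ⊆ d ∪ ⁅ u ⁆
    m′⊆d′ = subst (m′ ⊆_) d∪m′ (q⊆p∪q d m′)

  advance : ∀ {m m′} → ∃ (Optimal m) → Move m m′ → Closed m′ → NonNeg m′ → ∃ (Optimal m′)
  advance (_ , opt) (grow u) m′-closed m′-nonneg = optimise (extend u opt m′-closed m′-nonneg)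
  advance (_ , ((reach , d-closed , m⊆d , _) , _)) (shrink m′⊆m) _ _ =
    optimise (reach , d-closed , ⊆-trans m′⊆m m⊆d , ⊆-refl)

  follow : ∀ {m ms} → Linked Move (m ∷ ms) → All Closed ms → All NonNeg ms →
           ∃ (Optimal m) → All (∃ ∘ Optimal) ms
  follow [-]            []          []          _   = []
  follow (move ∷ moves) (cl ∷ cls) (nn ∷ nns) opt =
    opt′ ∷ follow moves cls nns opt′
    where opt′ = advance opt move cl nn

  optimal-⊥ : Optimal ⊥ ⊥
  optimal-⊥ = (ε , closed-⊥ , ⊆-refl , ⊆-refl) , ⊥-heaviest
    where
    ⊥-heaviest : Heaviest ⊥ ⊥ ⊥
    ⊥-heaviest z (_ , _ , z⊆⊥) = subst (λ s → W s ≤ W ⊥) (⊆-antisym ⊥⊆ z⊆⊥) O.refl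

  ⊤-reachable : ∀ {ms} → Linked Move (⊥ ∷ ms) → All Closed ms → All NonNeg ms →
                ⊤ ∈ₗ ms → Reachable ⊤
  ⊤-reachable moves cls nns ⊤∈ms
    with All.lookup (follow moves cls nns (⊥ , optimal-⊥)) ⊤∈ms
  ... | d , ((reach , _ , ⊤⊆d , _) , _) = subst Reachable (⊆-antisym ⊆⊤ ⊤⊆d) reach

-- The family of sets closed under the precedence induced by a list L

module Precedence {n} (L : List (Subset n)) where

  _≼_ : Fin n → Fin n → Set
  u ≼ v = All (λ m → v ∈ m → u ∈ m) L

  Closed : Subset n → Set
  Closed s = ∀ u v → u ≼ v → v ∈ s → u ∈ s

  closed? : Decidable Closed
  closed? s = Fin.all? λ u → Fin.all? λ v →
    All.all? (λ m → (v ∈? m) →-dec (u ∈? m)) L →-dec ((v ∈? s) →-dec (u ∈? s))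

  closed-⊥ : Closed ⊥
  closed-⊥ u v _ v∈⊥ = contradiction v∈⊥ ∉⊥

  closed-∪ : ∀ {p q} → Closed p → Closed q → Closed (p ∪ q)
  closed-∪ {p} {q} p-closed q-closed u v u≼v v∈p∪q =
    x∈p∪q⁺ (Data.Sum.map (p-closed u v u≼v) (q-closed u v u≼v) (x∈p∪q⁻ p q v∈p∪q))

  closed-∩ : ∀ {p q} → Closed p → Closed q → Closed (p ∩ q)
  closed-∩ {p} {q} p-closed q-closed u v u≼v v∈p∩q =
    x∈p∩q⁺ (Data.Product.map (p-closed u v u≼v) (q-closed u v u≼v) (x∈p∩q⁻ p q v∈p∩q))

  member-closed : ∀ {m} → m ∈ₗ L → Closed m
  member-closed m∈L u v u≼v = All.lookup u≼v m∈L

  -- If the members of L are inward closed, then an edge uv gives u ≼ v.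
  closed⇒inward : ∀ {E} → All (InwardClosed E) L → ∀ {s} → Closed s → InwardClosed E s
  closed⇒inward inward s-closed u v uv = s-closed u v (All.map (λ m-inward → m-inward u v uv) inward)

-- From reaching paths to mark sequences

module MarkChains {c ℓ₁ ℓ₂} (A : OrderedAbelianGroup c ℓ₁ ℓ₂) {n : ℕ}
    (E : Fin n → Fin n → Set) (w : Fin n → OrderedAbelianGroup.Carrier A)
    (Closed : Subset n → Set) (closed⇒inward : ∀ {s} → Closed s → InwardClosed E s) where
  open Paths A w Closed

  record MarkChain (d t : Subset n) : Set ℓ₂ where
    field
      rest   : List (Subset n)
      marks  : Linked (MarkStep E) (d ∷ rest)
      nonneg : NonNegative A w rest
      size   : length rest +ℕ ∣ d ∣ ≡ ∣ t ∣

  markChain : ∀ {d t} → Star Step d t → MarkChain d t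
  markChain ε = record { rest = [] ; marks = [-] ; nonneg = [] ; size = refl }
  markChain {d} (add u _ _ ◅ steps) with u ∈? d
  ... | yes u∈d = subst (λ s → MarkChain s _) (⊆⇒∪≡ (⁅⁆⊆ u∈d)) (markChain steps)
  markChain {d} {t} (add u d′-closed d′-nonneg ◅ steps) | no u∉d = record
    { rest   = d ∪ ⁅ u ⁆ ∷ rest
    ; marks  = (u , u∉d , refl , closed⇒inward d′-closed) ∷ marks
    ; nonneg = d′-nonneg ∷ nonneg
    ; size   = begin
        suc (length rest +ℕ ∣ d ∣)  ≡⟨ +-suc (length rest) ∣ d ∣ ⟨
        length rest +ℕ suc ∣ d ∣    ≡⟨ cong (length rest +ℕ_) (∣∪⁅⁆∣ d u u∉d) ⟨
        length rest +ℕ ∣ d ∪ ⁅ u ⁆ ∣ ≡⟨ size ⟩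
        ∣ t ∣                        ∎
    }
    where
    open MarkChain (markChain steps)
    open ≡-Reasoning

  -- The first set marked from ∅ is {v} for a source v: an edge into v
  -- would be a self-loop, since {v} is inward closed.
  first-mark : Acyclic E → ∀ {m} → MarkStep E ⊥ m → ∃ λ v → IsSource E v × m ≡ ⁅ v ⁆
  first-mark acyclic (v , _ , refl , inward) = v , source , ∪-identityˡ ⁅ v ⁆
    where
    source : IsSource E v
    source u uv with x∈⁅y⁆⇒x≡y v (subst (u ∈_) (∪-identityˡ ⁅ v ⁆)
                                   (inward u v uv (q⊆p∪q ⊥ ⁅ v ⁆ (x∈⁅x⁆ v))))
    ... | refl = acyclic u [ uv ]

  chain-length : ∀ {l : List (Subset n)} → length l +ℕ ∣ ⊥ {n} ∣ ≡ ∣ ⊤ {n} ∣ → length l ≡ n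
  chain-length {l} size = begin
    length l              ≡⟨ +-identityʳ (length l) ⟨
    length l +ℕ 0         ≡⟨ cong (length l +ℕ_) (∣⊥∣≡0 n) ⟨
    length l +ℕ ∣ ⊥ {n} ∣ ≡⟨ size ⟩
    ∣ ⊤ {n} ∣             ≡⟨ ∣⊤∣≡n n ⟩
    n                     ∎
    where open ≡-Reasoning

  -- On a non-empty vertex set, a path from ∅ to V(G) gives a mark sequence.
  markSequence : Acyclic E → Fin n → Reachable ⊤ →
                 ∃ λ ms → IsMarkSequence E ms × NonNegative A w ms
  markSequence acyclic v reach with markChain reach
  ... | record { rest = [] ; size = size } =
    contradiction (subst Fin (sym (chain-length {[]} size)) v) Fin.¬Fin0
  ... | record { rest = m ∷ rest ; marks = first ∷ marks ; nonneg = nonneg ; size = size }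
    with first-mark acyclic first
  ...   | u , source , refl =
    ⁅ u ⁆ ∷ rest , ((u , source , rest , refl) , marks , chain-length {m ∷ rest} size) , nonneg

inward-throughout : ∀ {n} {E : Fin n → Fin n → Set} {m ms} → InwardClosed E m →
                    Linked (MarkUnmarkStep E) (m ∷ ms) → All (InwardClosed E) (m ∷ ms)
inward-throughout m-inward [-] = m-inward ∷ []
inward-throughout m-inward (inj₁ (_ , _ , _ , m′-inward) ∷ steps) =
  m-inward ∷ inward-throughout m′-inward steps
inward-throughout m-inward (inj₂ (_ , _ , _ , m′-inward) ∷ steps) =
  m-inward ∷ inward-throughout m′-inward steps

source-inward : ∀ {n} {E : Fin n → Fin n → Set} {v} → IsSource E v → InwardClosed E ⁅ v ⁆
source-inward {v = v} source u v′ uv′ v′∈⁅v⁆ with x∈⁅y⁆⇒x≡y v v′∈⁅v⁆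
... | refl = contradiction uv′ (source u)

move : ∀ {n} {E : Fin n → Fin n → Set} {m m′} → MarkUnmarkStep E m m′ → Move m m′
move (inj₁ (u , _ , refl , _)) = grow u
move {m = m} (inj₂ (u , _ , refl , _)) = shrink (p─q⊆p m ⁅ u ⁆)

theorem1 : ∀ {c ℓ₁ ℓ₂} (A : OrderedAbelianGroup c ℓ₁ ℓ₂)
    (n : ℕ) (E : Fin n → Fin n → Set) → Acyclic E →
    (w : Fin n → OrderedAbelianGroup.Carrier A) →
    (∃ λ (Ms : List (Subset n)) → IsMarkUnmarkSequence E Ms × NonNegative A w Ms) →
    ∃ λ (Ms : List (Subset n)) → IsMarkSequence E Ms × NonNegative A w Ms
theorem1 A n E acyclic w
  (._ , ((v , source , rest , refl) , steps , (init , ends-at-⊤ , _)) , nonneg) =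
  markSequence acyclic v (⊤-reachable moves (All.tabulate member-closed) nonneg ⊤∈L)
  where
  L : List (Subset n)
  L = ⁅ v ⁆ ∷ rest
  open Precedence L
  open HeaviestReachable A w Closed closed? closed-⊥ closed-∪ closed-∩
  open MarkChains A E w Closed (closed⇒inward (inward-throughout (source-inward source) steps))
  -- Prefixing ∅ turns the start {v} into a move.
  moves : Linked Move (⊥ ∷ L)
  moves = subst (Move ⊥) (∪-identityˡ ⁅ v ⁆) (grow v) ∷ Linked.map move steps
  ⊤∈L : ⊤ ∈ₗ L
  ⊤∈L = subst (⊤ ∈ₗ_) (sym ends-at-⊤) (∈-++⁺ʳ init (here refl))
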